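{- Let $V$ be a set of $n$ vertices, and let $V_2,V_3$ be disjoint sets, disjoint from $V$, with $|V_2|=2n$ and $|V_3|=n$; let $V(H)=V\cup V_2\cup V_3$. Call a permutation $\pi_H$ of $V(H)$ good if $\pi_H(1)\in V_3$ and every prefix $\pi_H(1),\dots,\pi_H(j)$ contains at least as many vertices of $V_2$ as of $V$. Then: (1) for a uniformly random permutation $\pi_H$ of $V(H)$, $\Pr[\pi_H\text{ is good}]\ge \tfrac{1}{12}$; (2) if $\pi_H$ is a uniformly random good permutation, then $\pi_H[V]$ is a uniformly random permutation of $V$.
   Context: For $V'\subseteq V(H)$ and a permutation $\pi$ of $V(H)$, the restriction $\pi[V']$ is the permutation of $V'$ listing the elements of $V'$ in the order in which they appear in $\pi$. -}

module Defs where

open import Data.Bool using (Bool; true; false; _∧_; T)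
open import Data.Nat using (ℕ; _*_; _≤ᵇ_)
open import Data.Fin using (Fin; _≟_)
open import Data.Sum using (_⊎_; inj₁; inj₂)
open import Data.Maybe using (Maybe; just; nothing)
open import Data.List using (List; []; _∷_; [_]; map; _++_; concatMap; filter; filterᵇ; length; inits; allFin; mapMaybe)
open import Data.List.Properties using (≡-dec)
open import Data.Product using (_×_)
open import Relation.Nullary.Decidable using (T?; _×-dec_)
open import Relation.Binary.PropositionalEquality using (_≡_)

VH : ℕ → Set
VH n = Fin n ⊎ (Fin (2 * n) ⊎ Fin n)

isV isV₂ isV₃ : ∀ {n} → VH n → Bool
isV (inj₁ _) = true
isV _ = false
isV₂ (inj₂ (inj₁ _)) = true
isV₂ _ = false
isV₃ (inj₂ (inj₂ _)) = true
isV₃ _ = false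

allVH : ∀ n → List (VH n)
allVH n = map inj₁ (allFin n) ++ (map (λ x → inj₂ (inj₁ x)) (allFin (2 * n)) ++ map (λ x → inj₂ (inj₂ x)) (allFin n))

-- Enumeration of all permutations (orderings) of a list; for a duplicate-free
-- list of length m this lists each of its m! orderings exactly once.
insertions : ∀ {A : Set} → A → List A → List (List A)
insertions x [] = [ x ∷ [] ]
insertions x (y ∷ ys) = (x ∷ y ∷ ys) ∷ map (y ∷_) (insertions x ys)

perms : ∀ {A : Set} → List A → List (List A)
perms [] = [ [] ]
perms (x ∷ xs) = concatMap (insertions x) (perms xs)

allᵇ : ∀ {A : Set} → (A → Bool) → List A → Bool
allᵇ p [] = true
allᵇ p (x ∷ xs) = p x ∧ allᵇ p xs

cnt : ∀ {A : Set} → (A → Bool) → List A → ℕ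
cnt p xs = length (filterᵇ p xs)

firstInV₃ : ∀ {n} → List (VH n) → Bool
firstInV₃ [] = false
firstInV₃ (x ∷ _) = isV₃ x

good : ∀ {n} → List (VH n) → Bool
good π = firstInV₃ π ∧ allᵇ (λ pre → cnt isV pre ≤ᵇ cnt isV₂ pre) (inits π)

Good : ∀ {n} → List (VH n) → Set
Good π = T (good π)

fromV : ∀ {n} → VH n → Maybe (Fin n)
fromV (inj₁ v) = just v
fromV (inj₂ _) = nothing

restrictV : ∀ {n} → List (VH n) → List (Fin n)
restrictV = mapMaybe fromV

#good : ℕ → ℕ
#good n = length (filter (λ π → T? (good π)) (perms (allVH n)))

#goodWithRestriction : ∀ n → List (Fin n) → ℕ
#goodWithRestriction n σ =
  length (filter (λ π → T? (good π) ×-dec ≡-dec _≟_ (restrictV π) σ) (perms (allVH n)))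

-- Classifying the orderings of a vertex
-- list by their first vertex gives a recursion for the number of orderings whose prefixes
-- all have #V ≤ d + #V₂; the reflection principle solves it: with a vertices from V and b
-- from V₂, the orderings violating this make up the fraction a! b! / ((a-d-1)! (b+d+1)!).
-- For d = 0, a = n, b = 2n this is n/(2n+1), so a permutation starting in V₃ (a quarter of
-- them) is good with probability (n+1)/(2n+1), and (n+1)/(4(2n+1)) ≥ 1/12.
-- For (2), relabelling V along a permutation of V preserves goodness and acts on π[V] by
-- that permutation, so it carries the good π with π[V] = allFin n onto those with π[V] = σ.
module Submission where

open import Defs
open import Data.Bool using (Bool; true; false; T; _∧_)
open import Data.Empty using (⊥-elim)
open import Data.Fin using (Fin; cast; toℕ; _≟_)
open import Data.Fin.Properties using (toℕ-cast; toℕ-injective; cast-is-id)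
open import Data.List
  using (List; []; _∷_; map; _++_; concatMap; filter; length; lookup; tabulate; allFin; inits)
open import Data.List.Properties
  using ( map-∘; map-cong; map-++; map-tabulate; map-injective; map-concatMap; concatMap-map
        ; concatMap-cong; concatMap-++; length-++; length-tabulate; tabulate-lookup
        ; filter-++; filter-all; filter-none; filter-≐; ≡-dec)
open import Data.List.Relation.Binary.Permutation.Propositional
  using ( _↭_; refl; prep; swap; trans; ↭-refl; ↭-sym; ↭-trans; ↭-reflexive; ↭⇒↭ₛ
        ; module PermutationReasoning)
open import Data.List.Relation.Binary.Permutation.Propositional.Properties
  using (++⁺ˡ; ++⁺ʳ; ++⁺; shifts; map⁺; filter-↭; ↭-length)
import Data.List.Relation.Binary.Permutation.Setoid.Properties as Permutationₛ
open import Data.List.Relation.Unary.All as All using (All)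
open import Data.List.Relation.Unary.AllPairs using (_∷_)
open import Data.List.Relation.Unary.Unique.Propositional using (Unique)
open import Data.List.Relation.Unary.Unique.Propositional.Properties using (allFin⁺)
open import Data.List.Membership.Propositional.Properties using (∈-lookup)
open import Data.Nat using (ℕ; zero; suc; pred; _+_; _*_; _≤_; _≤ᵇ_; _!; s≤s)
open import Data.Nat.Properties
  using ( suc-injective; +-suc; +-identityʳ; *-zeroʳ; *-assoc; *-distribʳ-+; +-cancelʳ-≡
        ; *-cancelʳ-≡; *-cancelʳ-≤; m≤m+n; m≤n⇒m≤1+n; ≤-reflexive; _!*_!≢0)
open import Data.Nat.ListAction using (sum)
open import Data.Nat.Tactic.RingSolver using (solve-∀)
open import Data.Product using (Σ; _×_; _,_; map₂)
open import Data.Sum using (inj₁; inj₂)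
open import Function using (_∘_)
open import Function.Definitions using (Injective)
open import Level using (0ℓ)
open import Relation.Nullary using (¬_; does)
open import Relation.Nullary.Decidable using (T?; _×-dec_)
open import Relation.Unary using (Pred; Decidable; _≐_)
import Relation.Binary.PropositionalEquality as ≡
open ≡ using (_≡_; refl; sym; cong; cong₂; subst; subst₂; setoid; module ≡-Reasoning)

private
  variable
    A B C : Set
    xs ys : List A

-- Enumerating permutations

concatMap⁺ : (f : A → List B) → xs ↭ ys → concatMap f xs ↭ concatMap f ys
concatMap⁺ f refl         = ↭-refl
concatMap⁺ f (prep x p)   = ++⁺ˡ (f x) (concatMap⁺ f p)
concatMap⁺ f (swap x y p) =
  ↭-trans (shifts (f x) (f y)) (++⁺ˡ (f y) (++⁺ˡ (f x) (concatMap⁺ f p)))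
concatMap⁺ f (trans p q)  = ↭-trans (concatMap⁺ f p) (concatMap⁺ f q)

concatMap-cong-↭ : {f g : A → List B} → (∀ x → f x ↭ g x) →
                   (xs : List A) → concatMap f xs ↭ concatMap g xs
concatMap-cong-↭ f↭g []       = ↭-refl
concatMap-cong-↭ f↭g (x ∷ xs) = ++⁺ (f↭g x) (concatMap-cong-↭ f↭g xs)

concatMap-concatMap : (f : B → List C) (g : A → List B) (xs : List A) →
                      concatMap f (concatMap g xs) ≡ concatMap (concatMap f ∘ g) xs
concatMap-concatMap f g []       = refl
concatMap-concatMap f g (x ∷ xs) =
  ≡.trans (concatMap-++ f (g x) (concatMap g xs))
          (cong (concatMap f (g x) ++_) (concatMap-concatMap f g xs))

concatMap-∷-↭ : (f : A → B) (g : A → List B) (xs : List A) →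
                concatMap (λ x → f x ∷ g x) xs ↭ map f xs ++ concatMap g xs
concatMap-∷-↭ f g []       = ↭-refl
concatMap-∷-↭ f g (x ∷ xs) =
  prep (f x) (↭-trans (++⁺ˡ (g x) (concatMap-∷-↭ f g xs)) (shifts (g x) (map f xs)))

laterInsertions : A → List A → List (List A)
laterInsertions x []       = []
laterInsertions x (y ∷ ys) = map (y ∷_) (insertions x ys)

insertions-∷ : (x : A) (ys : List A) → insertions x ys ≡ (x ∷ ys) ∷ laterInsertions x ys
insertions-∷ x []       = refl
insertions-∷ x (y ∷ ys) = refl

concatMap-insertions : (x : A) (yss : List (List A)) →
  concatMap (insertions x) yss ↭ map (x ∷_) yss ++ concatMap (laterInsertions x) yss
concatMap-insertions x yss =
  ↭-trans (↭-reflexive (concatMap-cong (insertions-∷ x) yss))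
          (concatMap-∷-↭ (x ∷_) (laterInsertions x) yss)

concatMap-insertions-∷ : (x z : A) (yss : List (List A)) →
  concatMap (insertions x) (map (z ∷_) yss)
    ↭ map (x ∷_) (map (z ∷_) yss) ++ map (z ∷_) (concatMap (insertions x) yss)
concatMap-insertions-∷ x z yss =
  ↭-trans (concatMap-insertions x (map (z ∷_) yss))
          (++⁺ˡ (map (x ∷_) (map (z ∷_) yss)) (↭-reflexive later≡))
  where
  later≡ : concatMap (laterInsertions x) (map (z ∷_) yss)
         ≡ map (z ∷_) (concatMap (insertions x) yss)
  later≡ = ≡.trans (concatMap-map (laterInsertions x) (z ∷_) yss)
                   (sym (map-concatMap (z ∷_) (insertions x) yss))

insertions-comm : (x y : A) (zs : List A) →
  concatMap (insertions x) (insertions y zs) ↭ concatMap (insertions y) (insertions x zs)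
insertions-comm x y []       = swap (x ∷ y ∷ []) (y ∷ x ∷ []) ↭-refl
insertions-comm x y (z ∷ zs) = begin
    xyz ∷ yxz ∷ Y ++ concatMap (insertions x) (map (z ∷_) (insertions y zs))
  ↭⟨ prep xyz (prep yxz (++⁺ˡ Y (concatMap-insertions-∷ x z (insertions y zs)))) ⟩
    xyz ∷ yxz ∷ Y ++ X ++ map (z ∷_) (concatMap (insertions x) (insertions y zs))
  ↭⟨ swap xyz yxz (shifts Y X) ⟩
    yxz ∷ xyz ∷ X ++ Y ++ map (z ∷_) (concatMap (insertions x) (insertions y zs))
  ↭⟨ prep yxz (prep xyz (++⁺ˡ X (++⁺ˡ Y (map⁺ (z ∷_) (insertions-comm x y zs))))) ⟩
    yxz ∷ xyz ∷ X ++ Y ++ map (z ∷_) (concatMap (insertions y) (insertions x zs))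
  ↭⟨ prep yxz (prep xyz (++⁺ˡ X (concatMap-insertions-∷ y z (insertions x zs)))) ⟨
    yxz ∷ xyz ∷ X ++ concatMap (insertions y) (map (z ∷_) (insertions x zs))
  ∎
  where
  open PermutationReasoning
  xyz yxz : List _
  xyz = x ∷ y ∷ z ∷ zs
  yxz = y ∷ x ∷ z ∷ zs
  X Y : List (List _)
  X = map (x ∷_) (map (z ∷_) (insertions y zs))
  Y = map (y ∷_) (map (z ∷_) (insertions x zs))

perms-↭ : xs ↭ ys → perms xs ↭ perms ys
perms-↭ refl       = ↭-refl
perms-↭ (prep x p) = concatMap⁺ (insertions x) (perms-↭ p)
perms-↭ {xs = x ∷ y ∷ xs} {ys = .y ∷ .x ∷ ys} (swap .x .y p) = begin
    concatMap (insertions x) (concatMap (insertions y) (perms xs))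
  ≡⟨ concatMap-concatMap (insertions x) (insertions y) (perms xs) ⟩
    concatMap (concatMap (insertions x) ∘ insertions y) (perms xs)
  ↭⟨ concatMap-cong-↭ (insertions-comm x y) (perms xs) ⟩
    concatMap (concatMap (insertions y) ∘ insertions x) (perms xs)
  ≡⟨ concatMap-concatMap (insertions y) (insertions x) (perms xs) ⟨
    concatMap (insertions y) (concatMap (insertions x) (perms xs))
  ↭⟨ concatMap⁺ (insertions y) (concatMap⁺ (insertions x) (perms-↭ p)) ⟩
    perms (y ∷ x ∷ ys)
  ∎
  where open PermutationReasoning
perms-↭ (trans p q) = ↭-trans (perms-↭ p) (perms-↭ q)

map-insertions : (f : A → B) (x : A) (ys : List A) →
                 map (map f) (insertions x ys) ≡ insertions (f x) (map f ys)
map-insertions f x []       = refl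
map-insertions f x (y ∷ ys) = cong ((f x ∷ f y ∷ map f ys) ∷_) (begin
    map (map f) (map (y ∷_) (insertions x ys))
  ≡⟨ map-∘ (insertions x ys) ⟨
    map ((f y ∷_) ∘ map f) (insertions x ys)
  ≡⟨ map-∘ (insertions x ys) ⟩
    map (f y ∷_) (map (map f) (insertions x ys))
  ≡⟨ cong (map (f y ∷_)) (map-insertions f x ys) ⟩
    map (f y ∷_) (insertions (f x) (map f ys))
  ∎)
  where open ≡-Reasoning

map-perms : (f : A → B) (xs : List A) → map (map f) (perms xs) ≡ perms (map f xs)
map-perms f []       = refl
map-perms f (x ∷ xs) = begin
    map (map f) (concatMap (insertions x) (perms xs))
  ≡⟨ map-concatMap (map f) (insertions x) (perms xs) ⟩
    concatMap (map (map f) ∘ insertions x) (perms xs)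
  ≡⟨ concatMap-cong (map-insertions f x) (perms xs) ⟩
    concatMap (insertions (f x) ∘ map f) (perms xs)
  ≡⟨ concatMap-map (insertions (f x)) (map f) (perms xs) ⟨
    concatMap (insertions (f x)) (map (map f) (perms xs))
  ≡⟨ cong (concatMap (insertions (f x))) (map-perms f xs) ⟩
    perms (map f (x ∷ xs))
  ∎
  where open ≡-Reasoning

select : List A → List (A × List A)
select []       = []
select (x ∷ xs) = (x , xs) ∷ map (map₂ (x ∷_)) (select xs)

permsHeadedBy : A × List A → List (List A)
permsHeadedBy (z , rest) = map (z ∷_) (perms rest)

laterInsertions-permsHeadedBy : (x : A) (p : A × List A) →
  concatMap (laterInsertions x) (permsHeadedBy p) ≡ permsHeadedBy (map₂ (x ∷_) p)
laterInsertions-permsHeadedBy x (z , rest) =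
  ≡.trans (concatMap-map (laterInsertions x) (z ∷_) (perms rest))
          (sym (map-concatMap (z ∷_) (insertions x) (perms rest)))

perms-select : (x : A) (xs : List A) →
               perms (x ∷ xs) ↭ concatMap permsHeadedBy (select (x ∷ xs))
perms-select x []       = ↭-refl
perms-select x (y ∷ ys) = begin
    concatMap (insertions x) (perms (y ∷ ys))
  ↭⟨ concatMap-insertions x (perms (y ∷ ys)) ⟩
    headedByX ++ concatMap (laterInsertions x) (perms (y ∷ ys))
  ↭⟨ ++⁺ˡ headedByX (concatMap⁺ (laterInsertions x) (perms-select y ys)) ⟩
    headedByX ++ concatMap (laterInsertions x) (concatMap permsHeadedBy (select (y ∷ ys)))
  ≡⟨ cong (headedByX ++_) (concatMap-concatMap (laterInsertions x) permsHeadedBy (select (y ∷ ys))) ⟩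
    headedByX ++ concatMap (concatMap (laterInsertions x) ∘ permsHeadedBy) (select (y ∷ ys))
  ≡⟨ cong (headedByX ++_) (concatMap-cong (laterInsertions-permsHeadedBy x) (select (y ∷ ys))) ⟩
    headedByX ++ concatMap (permsHeadedBy ∘ map₂ (x ∷_)) (select (y ∷ ys))
  ≡⟨ cong (headedByX ++_) (concatMap-map permsHeadedBy (map₂ (x ∷_)) (select (y ∷ ys))) ⟨
    concatMap permsHeadedBy (select (x ∷ y ∷ ys))
  ∎
  where
  open PermutationReasoning
  headedByX : List (List _)
  headedByX = map (x ∷_) (perms (y ∷ ys))

module _ {P : Pred A 0ℓ} (P? : Decidable P) where

  count : List A → ℕ
  count xs = length (filter P? xs)

  count-↭ : xs ↭ ys → count xs ≡ count ys
  count-↭ p = ↭-length (filter-↭ P? p)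

  count-++ : (xs ys : List A) → count (xs ++ ys) ≡ count xs + count ys
  count-++ xs ys = ≡.trans (cong length (filter-++ P? xs ys)) (length-++ (filter P? xs))

  count-concatMap : (f : B → List A) (xs : List B) →
                    count (concatMap f xs) ≡ sum (map (count ∘ f) xs)
  count-concatMap f []       = refl
  count-concatMap f (x ∷ xs) =
    ≡.trans (count-++ (f x) (concatMap f xs)) (cong (count (f x) +_) (count-concatMap f xs))

  count-none : (∀ x → ¬ P x) → (xs : List A) → count xs ≡ 0
  count-none ¬P xs = cong length (filter-none P? (All.universal ¬P xs))

count-≐ : {P Q : Pred A 0ℓ} (P? : Decidable P) (Q? : Decidable Q) → P ≐ Q →
          (xs : List A) → count P? xs ≡ count Q? xs
count-≐ P? Q? P≐Q xs = cong length (filter-≐ P? Q? P≐Q xs)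

count-map : {P : Pred B 0ℓ} (P? : Decidable P) (f : A → B) (xs : List A) →
            count P? (map f xs) ≡ count (P? ∘ f) xs
count-map P? f []       = refl
count-map P? f (x ∷ xs) with does (P? (f x))
... | true  = cong suc (count-map P? f xs)
... | false = count-map P? f xs

sum-select : (φ : A × List A → ℕ) (k : A → ℕ) (xs : List A) →
             (∀ z rest → z ∷ rest ↭ xs → φ (z , rest) ≡ k z) →
             sum (map φ (select xs)) ≡ sum (map k xs)
sum-select φ k []       _ = refl
sum-select φ k (x ∷ xs) h = cong₂ _+_ (h x xs ↭-refl) (begin
    sum (map φ (map (map₂ (x ∷_)) (select xs)))
  ≡⟨ cong sum (map-∘ (select xs)) ⟨
    sum (map (φ ∘ map₂ (x ∷_)) (select xs))
  ≡⟨ sum-select (φ ∘ map₂ (x ∷_)) k xs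
       (λ z rest p → h z (x ∷ rest) (↭-trans (swap z x ↭-refl) (prep x p))) ⟩
    sum (map k xs)
  ∎)
  where open ≡-Reasoning

count-perms-∷ : {P : Pred (List A) 0ℓ} (P? : Decidable P) (k : A → ℕ) (x : A) (xs : List A) →
  (∀ z rest → z ∷ rest ↭ x ∷ xs → count (P? ∘ (z ∷_)) (perms rest) ≡ k z) →
  count P? (perms (x ∷ xs)) ≡ sum (map k (x ∷ xs))
count-perms-∷ P? k x xs byHead = begin
    count P? (perms (x ∷ xs))
  ≡⟨ count-↭ P? (perms-select x xs) ⟩
    count P? (concatMap permsHeadedBy (select (x ∷ xs)))
  ≡⟨ count-concatMap P? permsHeadedBy (select (x ∷ xs)) ⟩
    sum (map (count P? ∘ permsHeadedBy) (select (x ∷ xs)))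
  ≡⟨ sum-select (count P? ∘ permsHeadedBy) k (x ∷ xs)
       (λ z rest p → ≡.trans (count-map P? (z ∷_) (perms rest)) (byHead z rest p)) ⟩
    sum (map k (x ∷ xs))
  ∎
  where open ≡-Reasoning

count-perms-map : {P : Pred (List A) 0ℓ} (P? : Decidable P) (f : A → A) → map f xs ↭ xs →
                  count P? (perms xs) ≡ count (P? ∘ map f) (perms xs)
count-perms-map {xs = xs} P? f fxs↭xs = begin
    count P? (perms xs)                ≡⟨ count-↭ P? (perms-↭ fxs↭xs) ⟨
    count P? (perms (map f xs))        ≡⟨ cong (count P?) (map-perms f xs) ⟨
    count P? (map (map f) (perms xs))  ≡⟨ count-map P? (map f) (perms xs) ⟩
    count (P? ∘ map f) (perms xs)      ∎
  where open ≡-Reasoning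

-- The V₂- and V₃-clauses come first so that they reduce without splitting on d.
ballot : ∀ {n} → ℕ → List (VH n) → Bool
ballot d       []                  = true
ballot d       (inj₂ (inj₁ _) ∷ π) = ballot (suc d) π
ballot d       (inj₂ (inj₂ _) ∷ π) = ballot d π
ballot zero    (inj₁ _ ∷ π)        = false
ballot (suc d) (inj₁ _ ∷ π)        = ballot d π

allᵇ-map : (p : B → Bool) (f : A → B) (xs : List A) → allᵇ p (map f xs) ≡ allᵇ (p ∘ f) xs
allᵇ-map p f []       = refl
allᵇ-map p f (x ∷ xs) = cong (p (f x) ∧_) (allᵇ-map p f xs)

allᵇ-cong : {p q : A → Bool} → (∀ x → p x ≡ q x) → (xs : List A) → allᵇ p xs ≡ allᵇ q xs
allᵇ-cong p≗q []       = refl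
allᵇ-cong p≗q (x ∷ xs) = cong₂ _∧_ (p≗q x) (allᵇ-cong p≗q xs)

suc-≤ᵇ-suc : ∀ m n → (suc m ≤ᵇ suc n) ≡ (m ≤ᵇ n)
suc-≤ᵇ-suc zero    n = refl
suc-≤ᵇ-suc (suc m) n = refl

allᵇ-inits-ballot : ∀ {n} d (π : List (VH n)) →
  allᵇ (λ pre → cnt isV pre ≤ᵇ d + cnt isV₂ pre) (inits π) ≡ ballot d π
allᵇ-inits-ballot d []       = refl
allᵇ-inits-ballot d (x ∷ π) =
  ≡.trans (allᵇ-map (withSlack d) (x ∷_) (inits π)) (afterFirst d x)
  where
  withSlack : ℕ → List (VH _) → Bool
  withSlack d pre = cnt isV pre ≤ᵇ d + cnt isV₂ pre
  afterFirst : ∀ d x → allᵇ (withSlack d ∘ (x ∷_)) (inits π) ≡ ballot d (x ∷ π)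
  afterFirst zero    (inj₁ _)        = refl
  afterFirst (suc d) (inj₁ _)        =
    ≡.trans (allᵇ-cong (λ pre → suc-≤ᵇ-suc (cnt isV pre) (d + cnt isV₂ pre)) (inits π))
            (allᵇ-inits-ballot d π)
  afterFirst d       (inj₂ (inj₁ _)) =
    ≡.trans (allᵇ-cong (λ pre → cong (cnt isV pre ≤ᵇ_) (+-suc d (cnt isV₂ pre))) (inits π))
            (allᵇ-inits-ballot (suc d) π)
  afterFirst d       (inj₂ (inj₂ _)) = allᵇ-inits-ballot d π

good-ballot : ∀ {n} (π : List (VH n)) → good π ≡ firstInV₃ π ∧ ballot 0 π
good-ballot π = cong (firstInV₃ π ∧_) (allᵇ-inits-ballot 0 π)

-- Relabelling V

relabelV : ∀ {n} → (Fin n → Fin n) → VH n → VH n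
relabelV f (inj₁ v) = inj₁ (f v)
relabelV f (inj₂ w) = inj₂ w

ballot-relabelV : ∀ {n} (f : Fin n → Fin n) d (π : List (VH n)) →
                  ballot d (map (relabelV f) π) ≡ ballot d π
ballot-relabelV f d       []                  = refl
ballot-relabelV f zero    (inj₁ _ ∷ π)        = refl
ballot-relabelV f (suc d) (inj₁ _ ∷ π)        = ballot-relabelV f d π
ballot-relabelV f d       (inj₂ (inj₁ _) ∷ π) = ballot-relabelV f (suc d) π
ballot-relabelV f d       (inj₂ (inj₂ _) ∷ π) = ballot-relabelV f d π

firstInV₃-relabelV : ∀ {n} (f : Fin n → Fin n) (π : List (VH n)) →
                     firstInV₃ (map (relabelV f) π) ≡ firstInV₃ π
firstInV₃-relabelV f []           = refl
firstInV₃-relabelV f (inj₁ _ ∷ π) = refl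
firstInV₃-relabelV f (inj₂ _ ∷ π) = refl

good-relabelV : ∀ {n} (f : Fin n → Fin n) (π : List (VH n)) → good (map (relabelV f) π) ≡ good π
good-relabelV f π = begin
    good (map (relabelV f) π)
  ≡⟨ good-ballot (map (relabelV f) π) ⟩
    firstInV₃ (map (relabelV f) π) ∧ ballot 0 (map (relabelV f) π)
  ≡⟨ cong₂ _∧_ (firstInV₃-relabelV f π) (ballot-relabelV f 0 π) ⟩
    firstInV₃ π ∧ ballot 0 π
  ≡⟨ good-ballot π ⟨
    good π
  ∎
  where open ≡-Reasoning

restrictV-relabelV : ∀ {n} (f : Fin n → Fin n) (π : List (VH n)) →
                     restrictV (map (relabelV f) π) ≡ map f (restrictV π)
restrictV-relabelV f []           = refl
restrictV-relabelV f (inj₁ v ∷ π) = cong (f v ∷_) (restrictV-relabelV f π)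
restrictV-relabelV f (inj₂ _ ∷ π) = restrictV-relabelV f π

allVH-relabelV : ∀ {n} (f : Fin n → Fin n) → map f (allFin n) ↭ allFin n →
                 map (relabelV f) (allVH n) ↭ allVH n
allVH-relabelV {n} f f↭ = ↭-trans (↭-reflexive relabelled) (++⁺ʳ others (map⁺ inj₁ f↭))
  where
  others : List (VH n)
  others = map (inj₂ ∘ inj₁) (allFin (2 * n)) ++ map (inj₂ ∘ inj₂) (allFin n)
  fixesOthers : map (relabelV f) others ≡ others
  fixesOthers =
    ≡.trans (map-++ (relabelV f) (map (inj₂ ∘ inj₁) (allFin (2 * n))) (map (inj₂ ∘ inj₂) (allFin n)))
            (cong₂ _++_ (sym (map-∘ (allFin (2 * n)))) (sym (map-∘ (allFin n))))
  relabelled : map (relabelV f) (allVH n) ≡ map inj₁ (map f (allFin n)) ++ others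
  relabelled = begin
      map (relabelV f) (map inj₁ (allFin n) ++ others)
    ≡⟨ map-++ (relabelV f) (map inj₁ (allFin n)) others ⟩
      map (relabelV f) (map inj₁ (allFin n)) ++ map (relabelV f) others
    ≡⟨ cong₂ _++_ (≡.trans (sym (map-∘ (allFin n))) (map-∘ (allFin n))) fixesOthers ⟩
      map inj₁ (map f (allFin n)) ++ others
    ∎
    where open ≡-Reasoning

lookup-injective : (xs : List A) → Unique xs → Injective _≡_ _≡_ (lookup xs)
lookup-injective (x ∷ xs) _          {Fin.zero}  {Fin.zero}  _  = refl
lookup-injective (x ∷ xs) (x∉ ∷ _)   {Fin.zero}  {Fin.suc j} eq =
  ⊥-elim (All.lookup x∉ (∈-lookup j) eq)
lookup-injective (x ∷ xs) (x∉ ∷ _)   {Fin.suc i} {Fin.zero}  eq =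
  ⊥-elim (All.lookup x∉ (∈-lookup i) (sym eq))
lookup-injective (x ∷ xs) (_ ∷ uniq) {Fin.suc i} {Fin.suc j} eq =
  cong Fin.suc (lookup-injective xs uniq eq)

relabelling : ∀ {n} (σ : List (Fin n)) → σ ↭ allFin n →
              Σ (Fin n → Fin n) λ f → Injective _≡_ _≡_ f × map f (allFin n) ≡ σ
relabelling {n} σ σ↭ = lookup σ ∘ cast n≡∣σ∣ , injective , enumerates
  where
  n≡∣σ∣ : n ≡ length σ
  n≡∣σ∣ = ≡.trans (sym (length-tabulate (λ i → i))) (sym (↭-length σ↭))
  injective : Injective _≡_ _≡_ (lookup σ ∘ cast n≡∣σ∣)
  injective {i} {j} eq = toℕ-injective (begin
      toℕ i                 ≡⟨ toℕ-cast n≡∣σ∣ i ⟨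
      toℕ (cast n≡∣σ∣ i)    ≡⟨ cong toℕ (lookup-injective σ unique eq) ⟩
      toℕ (cast n≡∣σ∣ j)    ≡⟨ toℕ-cast n≡∣σ∣ j ⟩
      toℕ j                 ∎)
    where
    open ≡-Reasoning
    unique : Unique σ
    unique = Permutationₛ.Unique-resp-↭ (setoid (Fin n)) (↭⇒↭ₛ (↭-sym σ↭)) (allFin⁺ n)
  enumerates : map (lookup σ ∘ cast n≡∣σ∣) (allFin n) ≡ σ
  enumerates = go n≡∣σ∣
    where
    go : ∀ {m} (m≡ : m ≡ length σ) → map (lookup σ ∘ cast m≡) (allFin m) ≡ σ
    go refl = begin
        map (lookup σ ∘ cast refl) (allFin (length σ))
      ≡⟨ map-cong (λ i → cong (lookup σ) (cast-is-id refl i)) (allFin (length σ)) ⟩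
        map (lookup σ) (allFin (length σ))
      ≡⟨ map-tabulate (λ i → i) (lookup σ) ⟩
        tabulate (lookup σ)
      ≡⟨ tabulate-lookup σ ⟩
        σ
      ∎
      where open ≡-Reasoning

#goodWithRestriction-allFin : ∀ n (σ : List (Fin n)) → σ ↭ allFin n →
                              #goodWithRestriction n σ ≡ #goodWithRestriction n (allFin n)
#goodWithRestriction-allFin n σ σ↭ with relabelling σ σ↭
... | f , f-injective , f-enumerates = begin
    count (goodWith? σ) (perms (allVH n))
  ≡⟨ count-perms-map (goodWith? σ) (relabelV f)
       (allVH-relabelV f (↭-trans (↭-reflexive f-enumerates) σ↭)) ⟩
    count (goodWith? σ ∘ map (relabelV f)) (perms (allVH n))
  ≡⟨ count-≐ (goodWith? σ ∘ map (relabelV f)) (goodWith? (allFin n))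
       ((λ {π} → pullback π) , (λ {π} → pushforward π)) (perms (allVH n)) ⟩
    count (goodWith? (allFin n)) (perms (allVH n))
  ∎
  where
  open ≡-Reasoning
  goodWith? : (τ : List (Fin n)) → Decidable (λ π → T (good π) × restrictV π ≡ τ)
  goodWith? τ π = T? (good π) ×-dec ≡-dec _≟_ (restrictV π) τ
  pullback : ∀ π → T (good (map (relabelV f) π)) × restrictV (map (relabelV f) π) ≡ σ →
             T (good π) × restrictV π ≡ allFin n
  pullback π (isGood , restricts) =
    subst T (good-relabelV f π) isGood ,
    map-injective f-injective
      (≡.trans (sym (restrictV-relabelV f π)) (≡.trans restricts (sym f-enumerates)))
  pushforward : ∀ π → T (good π) × restrictV π ≡ allFin n →
                T (good (map (relabelV f) π)) × restrictV (map (relabelV f) π) ≡ σ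
  pushforward π (isGood , restricts) =
    subst T (sym (good-relabelV f π)) isGood ,
    ≡.trans (restrictV-relabelV f π) (≡.trans (cong (map f) restricts) f-enumerates)

-- Counting ballot orderings

classCounts : ∀ {n} → List (VH n) → ℕ × ℕ × ℕ
classCounts xs = cnt isV xs , cnt isV₂ xs , cnt isV₃ xs

classCounts-↭ : ∀ {n} {xs ys : List (VH n)} → xs ↭ ys → classCounts xs ≡ classCounts ys
classCounts-↭ p = cong₂ _,_ (count-↭ _ p) (cong₂ _,_ (count-↭ _ p) (count-↭ _ p))

byClass : ∀ {n} → ℕ → ℕ → ℕ → VH n → ℕ
byClass u v w (inj₁ _)        = u
byClass u v w (inj₂ (inj₁ _)) = v
byClass u v w (inj₂ (inj₂ _)) = w

sum-byClass : ∀ {n} (u v w : ℕ) (xs : List (VH n)) →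
  sum (map (byClass u v w) xs) ≡ cnt isV xs * u + cnt isV₂ xs * v + cnt isV₃ xs * w
sum-byClass u v w []       = refl
sum-byClass u v w (x ∷ xs) =
  ≡.trans (cong (byClass u v w x +_) (sum-byClass u v w xs)) (addHead x)
  where
  a b c : ℕ
  a = cnt isV xs
  b = cnt isV₂ xs
  c = cnt isV₃ xs
  addHead : ∀ x → byClass u v w x + (a * u + b * v + c * w)
                  ≡ cnt isV (x ∷ xs) * u + cnt isV₂ (x ∷ xs) * v + cnt isV₃ (x ∷ xs) * w
  addHead (inj₁ _)        = addV u v w a b c
    where
    addV : ∀ u v w a b c → u + (a * u + b * v + c * w) ≡ suc a * u + b * v + c * w
    addV = solve-∀
  addHead (inj₂ (inj₁ _)) = addV₂ u v w a b c
    where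
    addV₂ : ∀ u v w a b c → v + (a * u + b * v + c * w) ≡ a * u + suc b * v + c * w
    addV₂ = solve-∀
  addHead (inj₂ (inj₂ _)) = addV₃ u v w a b c
    where
    addV₃ : ∀ u v w a b c → w + (a * u + b * v + c * w) ≡ a * u + b * v + suc c * w
    addV₃ = solve-∀

-- ballotCount m a b c d is the number of orderings of m distinct vertices, a of them in V,
-- b in V₂ and c in V₃, that satisfy ballot d; ballotCountAfterV m a b c d is the number of
-- those orderings of m + 1 such vertices that start with one fixed V-vertex.
ballotCount ballotCountAfterV : (m a b c d : ℕ) → ℕ
ballotCount zero    a b c d = 1
ballotCount (suc m) a b c d =
  a * ballotCountAfterV m a b c d + b * ballotCount m a (pred b) c (suc d)
    + c * ballotCount m a b (pred c) d
ballotCountAfterV m a b c zero    = 0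
ballotCountAfterV m a b c (suc d) = ballotCount m (pred a) b c d

count-ballot : ∀ {n} m d (xs : List (VH n)) → length xs ≡ m →
  count (T? ∘ ballot d) (perms xs) ≡ ballotCount m (cnt isV xs) (cnt isV₂ xs) (cnt isV₃ xs) d
count-ballot zero    d []       _       = refl
count-ballot (suc m) d (x ∷ xs) ∣x∷xs∣ =
  ≡.trans (count-perms-∷ (T? ∘ ballot d) (byClass after₁ after₂ after₃) x xs
             (λ z rest p → byFirst z rest d (suc-injective (≡.trans (↭-length p) ∣x∷xs∣))
                                            (classCounts-↭ p)))
          (sum-byClass after₁ after₂ after₃ (x ∷ xs))
  where
  a b c after₁ after₂ after₃ : ℕ
  a = cnt isV (x ∷ xs)
  b = cnt isV₂ (x ∷ xs)
  c = cnt isV₃ (x ∷ xs)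
  after₁ = ballotCountAfterV m a b c d
  after₂ = ballotCount m a (pred b) c (suc d)
  after₃ = ballotCount m a b (pred c) d
  byFirst : ∀ z rest d {a b c} → length rest ≡ m → classCounts (z ∷ rest) ≡ (a , b , c) →
    count (T? ∘ ballot d ∘ (z ∷_)) (perms rest)
      ≡ byClass (ballotCountAfterV m a b c d) (ballotCount m a (pred b) c (suc d))
                (ballotCount m a b (pred c) d) z
  byFirst (inj₁ _)        rest zero    _      refl = count-none _ (λ _ ()) (perms rest)
  byFirst (inj₁ _)        rest (suc d) ∣rest∣ refl = count-ballot m d rest ∣rest∣
  byFirst (inj₂ (inj₁ _)) rest d       ∣rest∣ refl = count-ballot m (suc d) rest ∣rest∣
  byFirst (inj₂ (inj₂ _)) rest d       ∣rest∣ refl = count-ballot m d rest ∣rest∣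

count-good : ∀ {n a b c} (x : VH n) (xs : List (VH n)) → classCounts (x ∷ xs) ≡ (a , b , c) →
  count (T? ∘ good) (perms (x ∷ xs)) ≡ c * ballotCount (length xs) a b (pred c) 0
count-good {a = a} {b} {c} x xs refl =
  ≡.trans (count-perms-∷ (T? ∘ good) (byClass 0 0 G) x xs
             (λ z rest p → byFirst z rest (suc-injective (↭-length p)) (classCounts-↭ p)))
  (≡.trans (sum-byClass 0 0 G (x ∷ xs))
           (cong₂ (λ p q → p + q + c * G) (*-zeroʳ a) (*-zeroʳ b)))
  where
  G : ℕ
  G = ballotCount (length xs) a b (pred c) 0
  byFirst : ∀ z rest {a b c} → length rest ≡ length xs → classCounts (z ∷ rest) ≡ (a , b , c) →
    count (T? ∘ good ∘ (z ∷_)) (perms rest) ≡ byClass 0 0 (ballotCount (length xs) a b (pred c) 0) z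
  byFirst (inj₁ _)        rest _      _    = count-none _ (λ _ ()) (perms rest)
  byFirst (inj₂ (inj₁ _)) rest _      _    = count-none _ (λ _ ()) (perms rest)
  byFirst (inj₂ (inj₂ w)) rest ∣rest∣ refl =
    ≡.trans (count-≐ (T? ∘ good ∘ (inj₂ (inj₂ w) ∷_)) (T? ∘ ballot 0)
               ((λ {π} → subst T (good-ballot (inj₂ (inj₂ w) ∷ π)))
               , (λ {π} → subst T (sym (good-ballot (inj₂ (inj₂ w) ∷ π)))))
               (perms rest))
            (count-ballot (length xs) 0 rest ∣rest∣)

suc-middle-injective : ∀ a b c {m} → a + suc b + c ≡ suc m → a + b + c ≡ m
suc-middle-injective a b c eq = suc-injective (≡.trans (sym (cong (_+ c) (+-suc a b))) eq)

suc-last-injective : ∀ a b c {m} → a + b + suc c ≡ suc m → a + b + c ≡ m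
suc-last-injective a b c eq = suc-injective (≡.trans (sym (+-suc (a + b) c)) eq)

ballotCount≡m! : ∀ m a b c d → a + b + c ≡ m → a ≤ d → ballotCount m a b c d ≡ m !
ballotCount≡m! zero    a b c d _    _   = refl
ballotCount≡m! (suc m) a b c d sum≡ a≤d = begin
    a * ballotCountAfterV m a b c d + b * ballotCount m a (pred b) c (suc d)
      + c * ballotCount m a b (pred c) d
  ≡⟨ cong₂ _+_ (cong₂ _+_ (firstV a d sum≡ a≤d) (firstV₂ b sum≡)) (firstV₃ c sum≡) ⟩
    a * m ! + b * m ! + c * m !
  ≡⟨ ≡.trans (*-distribʳ-+ (m !) (a + b) c) (cong (_+ c * m !) (*-distribʳ-+ (m !) a b)) ⟨
    (a + b + c) * m !
  ≡⟨ cong (_* m !) sum≡ ⟩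
    suc m * m !
  ∎
  where
  open ≡-Reasoning
  firstV : ∀ a d → a + b + c ≡ suc m → a ≤ d → a * ballotCountAfterV m a b c d ≡ a * m !
  firstV zero    d       _    _         = refl
  firstV (suc a) (suc d) sum≡ (s≤s a≤d) =
    cong (suc a *_) (ballotCount≡m! m a b c d (suc-injective sum≡) a≤d)
  firstV₂ : ∀ b → a + b + c ≡ suc m → b * ballotCount m a (pred b) c (suc d) ≡ b * m !
  firstV₂ zero    _    = refl
  firstV₂ (suc b) sum≡ = cong (suc b *_) (ballotCount≡m! m a b c (suc d)
    (suc-middle-injective a b c sum≡) (m≤n⇒m≤1+n a≤d))
  firstV₃ : ∀ c → a + b + c ≡ suc m → c * ballotCount m a b (pred c) d ≡ c * m !
  firstV₃ zero    _    = refl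
  firstV₃ (suc c) sum≡ = cong (suc c *_) (ballotCount≡m! m a b c d
    (suc-last-injective a b c sum≡) a≤d)

-- The reflection principle, multiplied out: for a = d + e + 1 and S = d + b + 1 the orderings
-- violating ballot d are the fraction a! b! / (e! S!) of all of them. a and S are variables
-- tied down by equations so that the induction hypothesis applies up to +-suc.
Reflection : ℕ → Set
Reflection m = ∀ {a S} d e b c → a ≡ suc (d + e) → S ≡ suc (d + b) → e ≤ b → a + b + c ≡ m →
  ballotCount m a b c d * (e ! * S !) + m ! * (a ! * b !) ≡ m ! * (e ! * S !)

reflection-firstV : ∀ {m} → Reflection m → ∀ {a S} d e b c →
  a ≡ suc (d + e) → S ≡ suc (d + b) → e ≤ b → a + b + c ≡ suc m →
  a * ballotCountAfterV m a b c d * (e ! * S !) + S * (m ! * (a ! * b !)) ≡ a * (m ! * (e ! * S !))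
reflection-firstV {m} ih zero    e b c refl refl _ _ = regroup e b (m !) (e !) (b !)
  where
  regroup : ∀ e b M E B →
    suc e * 0 * (E * (suc b * B)) + suc b * (M * ((suc e * E) * B)) ≡ suc e * (M * (E * (suc b * B)))
  regroup = solve-∀
reflection-firstV {m} ih (suc d) e b c refl refl e≤b sum≡ = begin
    a * G * (e ! * (S * S′ !)) + S * (m ! * ((a * a′ !) * b !))
  ≡⟨ regroup a S G (e !) (S′ !) (a′ !) (b !) (m !) ⟩
    (a * S) * (G * (e ! * S′ !) + m ! * (a′ ! * b !))
  ≡⟨ cong ((a * S) *_) (ih d e b c refl refl e≤b (suc-injective sum≡)) ⟩
    (a * S) * (m ! * (e ! * S′ !))
  ≡⟨ regroup′ a S (e !) (S′ !) (m !) ⟩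
    a * (m ! * (e ! * (S * S′ !)))
  ∎
  where
  open ≡-Reasoning
  a a′ S S′ G : ℕ
  a′ = suc (d + e)
  a  = suc a′
  S′ = suc (d + b)
  S  = suc S′
  G  = ballotCount m a′ b c d
  regroup : ∀ a S G E S′ A′ B M →
    a * G * (E * (S * S′)) + S * (M * ((a * A′) * B)) ≡ (a * S) * (G * (E * S′) + M * (A′ * B))
  regroup = solve-∀
  regroup′ : ∀ a S E S′ M → (a * S) * (M * (E * S′)) ≡ a * (M * (E * (S * S′)))
  regroup′ = solve-∀

reflection-firstV₂ : ∀ {m} → Reflection m → ∀ {a S} d e b c →
  a ≡ suc (d + e) → S ≡ suc (d + b) → e ≤ b → a + b + c ≡ suc m →
  b * ballotCount m a (pred b) c (suc d) * (e ! * S !) + e * (m ! * (a ! * b !)) ≡ b * (m ! * (e ! * S !))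
reflection-firstV₂ ih d zero zero c _ _ _ _ = refl
-- For e = 0 the slack d + 1 left after a V₂-vertex is a, so no ordering of the rest can fail.
reflection-firstV₂ {m} ih {a} {S} d zero (suc b) c refl _ _ sum≡ = begin
    suc b * G * (1 * S !) + 0
  ≡⟨ +-identityʳ _ ⟩
    suc b * G * (1 * S !)
  ≡⟨ cong (λ g → suc b * g * (1 * S !)) all≡ ⟩
    suc b * m ! * (1 * S !)
  ≡⟨ *-assoc (suc b) (m !) (1 * S !) ⟩
    suc b * (m ! * (1 * S !))
  ∎
  where
  open ≡-Reasoning
  G : ℕ
  G = ballotCount m a b c (suc d)
  all≡ : G ≡ m !
  all≡ = ballotCount≡m! m a b c (suc d)
    (suc-middle-injective a b c sum≡)
    (s≤s (≤-reflexive (+-identityʳ d)))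
reflection-firstV₂ {m} ih {a} {S} d (suc e) (suc b) c a≡ S≡ (s≤s e≤b) sum≡ = begin
    suc b * G * ((suc e * e !) * S !) + suc e * (m ! * (a ! * (suc b * b !)))
  ≡⟨ regroup (suc b) (suc e) G (e !) (S !) (m !) (a !) (b !) ⟩
    (suc b * suc e) * (G * (e ! * S !) + m ! * (a ! * b !))
  ≡⟨ cong ((suc b * suc e) *_) (ih (suc d) e b c
       (≡.trans a≡ (cong suc (+-suc d e))) (≡.trans S≡ (cong suc (+-suc d b))) e≤b
       (suc-middle-injective a b c sum≡)) ⟩
    (suc b * suc e) * (m ! * (e ! * S !))
  ≡⟨ regroup′ (suc b) (suc e) (e !) (S !) (m !) ⟩
    suc b * (m ! * ((suc e * e !) * S !))
  ∎
  where
  open ≡-Reasoning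
  G : ℕ
  G = ballotCount m a b c (suc d)
  regroup : ∀ b e G E S M A B →
    b * G * ((e * E) * S) + e * (M * (A * (b * B))) ≡ (b * e) * (G * (E * S) + M * (A * B))
  regroup = solve-∀
  regroup′ : ∀ b e E S M → (b * e) * (M * (E * S)) ≡ b * (M * ((e * E) * S))
  regroup′ = solve-∀

reflection-firstV₃ : ∀ {m} → Reflection m → ∀ {a S} d e b c →
  a ≡ suc (d + e) → S ≡ suc (d + b) → e ≤ b → a + b + c ≡ suc m →
  c * ballotCount m a b (pred c) d * (e ! * S !) + c * (m ! * (a ! * b !)) ≡ c * (m ! * (e ! * S !))
reflection-firstV₃ ih d e b zero _ _ _ _ = refl
reflection-firstV₃ {m} ih {a} {S} d e b (suc c) a≡ S≡ e≤b sum≡ =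
  ≡.trans (regroup (suc c) (ballotCount m a b c d) (e ! * S !) (m ! * (a ! * b !)))
          (cong (suc c *_) (ih d e b c a≡ S≡ e≤b (suc-last-injective a b c sum≡)))
  where
  regroup : ∀ c G E X → c * G * E + c * X ≡ c * (G * E + X)
  regroup = solve-∀

ballotCount-reflection : ∀ m → Reflection m
ballotCount-reflection zero d e b c refl _ _ ()
ballotCount-reflection (suc m) {a} {S} d e b c a≡ S≡ e≤b sum≡ = begin
    (x + y + z) * E + (suc m * M) * AB
  ≡⟨ cong (λ k → (x + y + z) * E + (k * M) * AB) (≡.trans (S+e≡a+b a≡ S≡) sum≡) ⟨
    (x + y + z) * E + ((S + e + c) * M) * AB
  ≡⟨ regroup x y z E S e c M AB ⟩
    (x * E + S * (M * AB)) + (y * E + e * (M * AB)) + (z * E + c * (M * AB))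
  ≡⟨ cong₂ _+_ (cong₂ _+_ (reflection-firstV ih d e b c a≡ S≡ e≤b sum≡)
                          (reflection-firstV₂ ih d e b c a≡ S≡ e≤b sum≡))
               (reflection-firstV₃ ih d e b c a≡ S≡ e≤b sum≡) ⟩
    a * (M * E) + b * (M * E) + c * (M * E)
  ≡⟨ regroup′ a b c M E ⟩
    ((a + b + c) * M) * E
  ≡⟨ cong (λ k → (k * M) * E) sum≡ ⟩
    (suc m * M) * E
  ∎
  where
  open ≡-Reasoning
  ih : Reflection m
  ih = ballotCount-reflection m
  x y z E M AB : ℕ
  x  = a * ballotCountAfterV m a b c d
  y  = b * ballotCount m a (pred b) c (suc d)
  z  = c * ballotCount m a b (pred c) d
  E  = e ! * S !
  M  = m !
  AB = a ! * b !
  S+e≡a+b : ∀ {a S} → a ≡ suc (d + e) → S ≡ suc (d + b) → S + e + c ≡ a + b + c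
  S+e≡a+b refl refl = cong (λ k → suc k + c) (swap-ends d b e)
    where
    swap-ends : ∀ d b e → d + b + e ≡ d + e + b
    swap-ends = solve-∀
  regroup : ∀ x y z E S e c M AB → (x + y + z) * E + ((S + e + c) * M) * AB
    ≡ (x * E + S * (M * AB)) + (y * E + e * (M * AB)) + (z * E + c * (M * AB))
  regroup = solve-∀
  regroup′ : ∀ a b c M E → a * (M * E) + b * (M * E) + c * (M * E) ≡ ((a + b + c) * M) * E
  regroup′ = solve-∀

length-classCounts : ∀ {n} (xs : List (VH n)) → length xs ≡ cnt isV xs + cnt isV₂ xs + cnt isV₃ xs
length-classCounts []                   = refl
length-classCounts (inj₁ _ ∷ xs)        = cong suc (length-classCounts xs)
length-classCounts (inj₂ (inj₁ _) ∷ xs) =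
  ≡.trans (cong suc (length-classCounts xs))
          (sym (cong (_+ cnt isV₃ xs) (+-suc (cnt isV xs) (cnt isV₂ xs))))
length-classCounts (inj₂ (inj₂ _) ∷ xs) =
  ≡.trans (cong suc (length-classCounts xs)) (sym (+-suc (cnt isV xs + cnt isV₂ xs) (cnt isV₃ xs)))

cnt-allVH : ∀ n (p : VH n → Bool) → cnt p (allVH n)
  ≡ cnt (p ∘ inj₁) (allFin n)
    + (cnt (p ∘ inj₂ ∘ inj₁) (allFin (2 * n)) + cnt (p ∘ inj₂ ∘ inj₂) (allFin n))
cnt-allVH n p = begin
    cnt p (V ++ V₂ ++ V₃)
  ≡⟨ count-++ (T? ∘ p) V (V₂ ++ V₃) ⟩
    cnt p V + cnt p (V₂ ++ V₃)
  ≡⟨ cong (cnt p V +_) (count-++ (T? ∘ p) V₂ V₃) ⟩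
    cnt p V + (cnt p V₂ + cnt p V₃)
  ≡⟨ cong₂ _+_ (count-map (T? ∘ p) inj₁ (allFin n))
               (cong₂ _+_ (count-map (T? ∘ p) (inj₂ ∘ inj₁) (allFin (2 * n)))
                          (count-map (T? ∘ p) (inj₂ ∘ inj₂) (allFin n))) ⟩
    cnt (p ∘ inj₁) (allFin n)
      + (cnt (p ∘ inj₂ ∘ inj₁) (allFin (2 * n)) + cnt (p ∘ inj₂ ∘ inj₂) (allFin n))
  ∎
  where
  open ≡-Reasoning
  V V₂ V₃ : List (VH n)
  V  = map inj₁ (allFin n)
  V₂ = map (inj₂ ∘ inj₁) (allFin (2 * n))
  V₃ = map (inj₂ ∘ inj₂) (allFin n)

cnt-true-allFin : ∀ k → cnt (λ (_ : Fin k) → true) (allFin k) ≡ k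
cnt-true-allFin k =
  ≡.trans (cong length (filter-all (T? ∘ λ _ → true) (All.universal _ (allFin k))))
          (length-tabulate (λ i → i))

cnt-false : (xs : List A) → cnt (λ _ → false) xs ≡ 0
cnt-false = count-none _ (λ _ ())

classCounts-allVH : ∀ n → classCounts (allVH n) ≡ (n , 2 * n , n)
classCounts-allVH n = cong₂ _,_ #V (cong₂ _,_ #V₂ #V₃)
  where
  #V : cnt isV (allVH n) ≡ n
  #V = ≡.trans (cnt-allVH n isV)
         (≡.trans (cong₂ _+_ (cnt-true-allFin n)
                             (cong₂ _+_ (cnt-false (allFin (2 * n))) (cnt-false (allFin n))))
                  (+-identityʳ n))
  #V₂ : cnt isV₂ (allVH n) ≡ 2 * n
  #V₂ = ≡.trans (cnt-allVH n isV₂)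
          (≡.trans (cong₂ _+_ (cnt-false (allFin n))
                               (cong₂ _+_ (cnt-true-allFin (2 * n)) (cnt-false (allFin n))))
                   (+-identityʳ (2 * n)))
  #V₃ : cnt isV₃ (allVH n) ≡ n
  #V₃ = ≡.trans (cnt-allVH n isV₃)
          (cong₂ _+_ (cnt-false (allFin n))
                     (cong₂ _+_ (cnt-false (allFin (2 * n))) (cnt-true-allFin n)))

allVH-∷ : ∀ n → Σ (List (VH (suc n))) λ xs → allVH (suc n) ≡ inj₁ Fin.zero ∷ xs
allVH-∷ n = _ , refl

ballot-ratio : ∀ n G K →
  G * (n ! * suc (2 * suc n) !) + K * (suc n ! * (2 * suc n) !) ≡ K * (n ! * suc (2 * suc n) !) →
  G * suc (2 * suc n) ≡ K * suc (suc n)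
ballot-ratio n G K reflection =
  +-cancelʳ-≡ (K * suc n) (G * suc (2 * suc n)) (K * suc (suc n))
    (*-cancelʳ-≡ _ _ (n ! * (2 * suc n) !) {{n !* (2 * suc n) !≢0}}
      (≡.trans (factorLeft n G K (n !) ((2 * suc n) !))
        (≡.trans reflection (factorRight n K (n !) ((2 * suc n) !)))))
  where
  factorLeft : ∀ n G K F F₂ → (G * suc (2 * suc n) + K * suc n) * (F * F₂)
    ≡ G * (F * (suc (2 * suc n) * F₂)) + K * ((suc n * F) * F₂)
  factorLeft = solve-∀
  factorRight : ∀ n K F F₂ → K * (F * (suc (2 * suc n) * F₂))
    ≡ (K * suc (suc n) + K * suc n) * (F * F₂)
  factorRight = solve-∀

twelfth-bound : ∀ N G K → G * suc (2 * N) ≡ K * suc N → 4 * N * K ≤ 12 * (N * G)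
twelfth-bound N G K ratio = *-cancelʳ-≤ (4 * N * K) (12 * (N * G)) (suc (2 * N))
  (subst (4 * N * K * suc (2 * N) ≤_) (sym scaled)
         (m≤m+n (4 * N * K * suc (2 * N)) (4 * N * K * (N + 2))))
  where
  scaled : 12 * (N * G) * suc (2 * N) ≡ 4 * N * K * suc (2 * N) + 4 * N * K * (N + 2)
  scaled = ≡.trans (regroup N G) (≡.trans (cong (12 * N *_) ratio) (regroup′ N K))
    where
    regroup : ∀ N G → 12 * (N * G) * suc (2 * N) ≡ 12 * N * (G * suc (2 * N))
    regroup = solve-∀
    regroup′ : ∀ N K → 12 * N * (K * suc N) ≡ 4 * N * K * suc (2 * N) + 4 * N * K * (N + 2)
    regroup′ = solve-∀

#good-bound : ∀ n → 1 ≤ n → (4 * n) ! ≤ 12 * #good n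
#good-bound (suc n) _ with allVH-∷ n
... | xs , allVH≡ =
  subst₂ _≤_ (≡.trans (cong (_* m !) 4N≡) (cong _! (sym 4N≡))) (cong (12 *_) (sym #good≡))
    (twelfth-bound N G (m !) (ballot-ratio n G (m !)
      (ballotCount-reflection m 0 n (2 * N) n refl refl (m≤n⇒m≤1+n (m≤m+n n _)) size≡)))
  where
  N m G : ℕ
  N = suc n
  m = length xs
  G = ballotCount m N (2 * N) n 0
  counts : classCounts (inj₁ Fin.zero ∷ xs) ≡ (N , 2 * N , N)
  counts = ≡.trans (cong classCounts (sym allVH≡)) (classCounts-allVH N)
  #good≡ : #good N ≡ N * G
  #good≡ = ≡.trans (cong (count (T? ∘ good) ∘ perms) allVH≡) (count-good (inj₁ Fin.zero) xs counts)
  suc-m≡ : suc m ≡ N + 2 * N + N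
  suc-m≡ = ≡.trans (≡.trans (cong length (sym allVH≡)) (length-classCounts (allVH N)))
                   (cong (λ { (a , b , c) → a + b + c }) (classCounts-allVH N))
  4N≡ : 4 * N ≡ suc m
  4N≡ = ≡.trans (four n) (sym suc-m≡)
    where
    four : ∀ n → 4 * suc n ≡ suc n + 2 * suc n + suc n
    four = solve-∀
  size≡ : N + 2 * N + n ≡ m
  size≡ = suc-injective (≡.trans (sym (+-suc (N + 2 * N) n)) (sym suc-m≡))

lemma3p11 : (n : ℕ) → 1 ≤ n →
    ((4 * n) ! ≤ 12 * #good n)
    × ((σ τ : List (Fin n)) → σ ↭ allFin n → τ ↭ allFin n →
        #goodWithRestriction n σ ≡ #goodWithRestriction n τ)
lemma3p11 n 1≤n =
  #good-bound n 1≤n ,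
  λ σ τ σ↭ τ↭ →
    ≡.trans (#goodWithRestriction-allFin n σ σ↭) (sym (#goodWithRestriction-allFin n τ τ↭))
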